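{- Let $\mathsf{B}$ be a bad piece. Then for any two distinct vertices $v_1, v_2 \in V(\mathsf{B})$, there exists a subgraph of $\mathsf{B}$ that is a rainbow path with terminals $v_1$ and $v_2$.
   Context: A (colored) graph is a finite set $\mathsf{G}$ of pairs $(e,\alpha)$ where $e=\{u,v\}$ is a set of two distinct vertices and $\alpha$ is a color, such that no two pairs in $\mathsf{G}$ have the same $e$ (colors may repeat). $V(\mathsf{G})$ is the set of all vertices of its edges, $E(\mathsf{G})$ the set of underlying (uncolored) edges, $\chi(\mathsf{G})$ the set of colors used. A subgraph is a subset. $\mathsf{G}$ is rainbow if $|\chi(\mathsf{G})| = |\mathsf{G}|$ and almost rainbow if $|\chi(\mathsf{G})| = |\mathsf{G}|-1$. A path (resp. cycle, tree) is a graph whose underlying edge set forms a path (resp. cycle, tree). A theta graph is a union $\mathsf{P}_1\cup\mathsf{P}_2\cup\mathsf{P}_3$ of three paths with common terminals $s,t$ such that any two of them share exactly the vertices $s,t$ and no edges. A bad piece is an almost rainbow theta graph $\mathsf{B}=\mathsf{P}_1\cup\mathsf{P}_2\cup\mathsf{P}_3$ in which each $\mathsf{P}_i$ is a rainbow path and $|V(\mathsf{B})|\ge 6$. -}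

module Defs where

open import Data.Nat using (ℕ; _≤_; _≥_; _+_)
open import Data.Nat.Properties using (_≟_)
open import Data.List using (List; []; _∷_; map; length; deduplicate; zip; drop; head; last; _++_)
open import Data.List.Relation.Unary.Any using (Any)
open import Data.List.Relation.Unary.All using (All)
open import Data.List.Relation.Unary.AllPairs using (AllPairs)
open import Data.List.Relation.Unary.Unique.Propositional using (Unique)
open import Data.Maybe using (just)
open import Data.Product using (Σ; _×_; _,_; ∃-syntax)
open import Data.Sum using (_⊎_)
open import Relation.Binary.PropositionalEquality using (_≡_; _≢_)
open import Relation.Nullary using (¬_)
open import Data.Empty using (⊥)
open import Function.Bundles using (_⇔_)

Vertex : Set
Vertex = ℕ

Color : Set
Color = ℕ

-- A coloured edge (u , v , α) stands for the pair ({u,v}, α);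
-- orientation of (u , v) is irrelevant.
CEdge : Set
CEdge = Vertex × Vertex × Color

CGraph : Set
CGraph = List CEdge

SameEdge : Vertex → Vertex → Vertex → Vertex → Set
SameEdge u v u' v' = (u ≡ u' × v ≡ v') ⊎ (u ≡ v' × v ≡ u')

-- Well-formedness: every edge has two distinct endpoints, and no two
-- entries of the list have the same underlying edge {u,v}.
-- (So the list is a faithful presentation of a set of pairs (e, α).)
WellFormed : CGraph → Set
WellFormed G =
  All (λ { (u , v , _) → u ≢ v }) G ×
  AllPairs (λ { (u , v , _) (u' , v' , _) → ¬ SameEdge u v u' v' }) G

_∈C_ : CEdge → CGraph → Set
(u , v , c) ∈C G = Any (λ { (u' , v' , c') → SameEdge u v u' v' × c ≡ c' }) G

EdgeIn : Vertex → Vertex → CGraph → Set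
EdgeIn u v G = Any (λ { (u' , v' , _) → SameEdge u v u' v' }) G

_∈V_ : Vertex → CGraph → Set
v ∈V G = Any (λ { (u , w , _) → v ≡ u ⊎ v ≡ w }) G

vertexList : CGraph → List Vertex
vertexList [] = []
vertexList ((u , v , _) ∷ G) = u ∷ v ∷ vertexList G

numVertices : CGraph → ℕ
numVertices G = length (deduplicate _≟_ (vertexList G))

colorList : CGraph → List Color
colorList G = map (λ { (_ , _ , c) → c }) G

numColors : CGraph → ℕ
numColors G = length (deduplicate _≟_ (colorList G))

Subgraph : CGraph → CGraph → Set
Subgraph H G = ∀ e → e ∈C H → e ∈C G

SameGraph : CGraph → CGraph → Set
SameGraph G H = ∀ e → (e ∈C G) ⇔ (e ∈C H)

Rainbow : CGraph → Set
Rainbow G = numColors G ≡ length G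

AlmostRainbow : CGraph → Set
AlmostRainbow G = numColors G + 1 ≡ length G

consecutive : List Vertex → List (Vertex × Vertex)
consecutive xs = zip xs (drop 1 xs)

IsPath : CGraph → Vertex → Vertex → Set
IsPath G s t =
  WellFormed G ×
  Σ (List Vertex) λ xs →
    Unique xs × 2 ≤ length xs ×
    head xs ≡ just s × last xs ≡ just t ×
    All (λ { (a , b) → EdgeIn a b G }) (consecutive xs) ×
    All (λ { (u , v , _) → Any (λ { (a , b) → SameEdge u v a b }) (consecutive xs) }) G

SharesExactlyTerminals : CGraph → CGraph → Vertex → Vertex → Set
SharesExactlyTerminals P Q s t =
  (∀ v → v ∈V P → v ∈V Q → v ≡ s ⊎ v ≡ t) ×
  (∀ u v → EdgeIn u v P → EdgeIn u v Q → ⊥)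

BadPiece : CGraph → Set
BadPiece B =
  WellFormed B ×
  Σ Vertex λ s → Σ Vertex λ t → Σ CGraph λ P₁ → Σ CGraph λ P₂ → Σ CGraph λ P₃ →
    IsPath P₁ s t × IsPath P₂ s t × IsPath P₃ s t ×
    SharesExactlyTerminals P₁ P₂ s t ×
    SharesExactlyTerminals P₁ P₃ s t ×
    SharesExactlyTerminals P₂ P₃ s t ×
    SameGraph B (P₁ ++ P₂ ++ P₃) ×
    Rainbow P₁ × Rainbow P₂ × Rainbow P₃ ×
    AlmostRainbow B ×
    numVertices B ≥ 6

module Submission where

-- If v₁ and v₂ lie on a common branch of the theta graph, the segment of that branch
-- between them is rainbow because the branch is.  Otherwise v₁ is interior to a branch P
-- and v₂ to another branch Q, and two paths join them: along P to the terminal s and on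
-- along Q, and likewise through t.  As P and Q are rainbow, a repeated colour on either
-- path pairs an edge of P with an edge of Q.  If both paths failed, the four edges so
-- obtained would be pairwise distinct (the two P-edges lie on opposite sides of v₁, the
-- two Q-edges on opposite sides of v₂), so B would have two repeated colours, whereas an
-- almost rainbow graph has only one.

open import Data.Empty using (⊥; ⊥-elim)
open import Data.Fin using (Fin; zero; suc)
import Data.Fin as Fin
open import Data.List using (List; []; _∷_; _++_; length; filter; reverse; deduplicate; head; last)
open import Data.List.Properties
  using (length-filter; filter-all; filter-notAll; length-map; ++-assoc; unfold-reverse; reverse-++; reverse-involutive)
open import Data.List.Membership.Propositional using (_∈_; _∉_; find; lose)
open import Data.List.Membership.Propositional.Properties
  using (deduplicate-∈⇔; ∈-filter⁻; ∈-filter⁺; ∈-∃++)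
open import Data.List.Relation.Unary.All using (All; []; _∷_)
import Data.List.Relation.Unary.All as All
import Data.List.Relation.Unary.All.Properties as AllP
open import Data.List.Relation.Unary.AllPairs using (AllPairs; []; _∷_)
import Data.List.Relation.Unary.AllPairs.Properties as AllPairsP
open import Data.List.Relation.Unary.Any using (Any; here; there; any?)
import Data.List.Relation.Unary.Any as Any
import Data.List.Relation.Unary.Any.Properties as AnyP
open import Data.List.Relation.Unary.Unique.Propositional using (Unique)
import Data.List.Relation.Unary.Unique.Propositional.Properties as UniqueP
open import Data.List.Relation.Unary.Unique.Propositional.Properties using (Unique[x∷xs]⇒x∉xs)
open import Data.Maybe using (just)
open import Data.Nat using (ℕ; suc; _+_; _≤_; _<_; z≤n; s≤s)
open import Data.Nat.Properties using (_≟_; ≤-trans; ≤-reflexive; <-irrefl; +-comm)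
open import Data.List.Membership.DecPropositional _≟_ using (_∈?_)
import Data.Product as Product
open import Data.Product using (Σ; ∃; ∃₂; _×_; _,_; proj₁; proj₂)
open import Data.Sum using (_⊎_; inj₁; inj₂)
import Data.Sum as Sum
open import Function using (_∘_)
open import Function.Bundles using (Equivalence)
open import Relation.Binary.PropositionalEquality using (_≡_; _≢_; refl; sym; trans; cong; subst)
open import Relation.Nullary using (¬_; Dec; yes; no; ¬?)
open import Relation.Nullary.Decidable using (_×-dec_; _⊎-dec_)

open import Defs

end₁ end₂ : CEdge → Vertex
end₁ (u , _ , _) = u
end₂ (_ , v , _) = v

color : CEdge → Color
color (_ , _ , c) = c

_≈ₑ_ : CEdge → CEdge → Set
x ≈ₑ y = SameEdge (end₁ x) (end₂ x) (end₁ y) (end₂ y)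

SameEdge-sym : ∀ {u v u' v'} → SameEdge u v u' v' → SameEdge u' v' u v
SameEdge-sym (inj₁ (refl , refl)) = inj₁ (refl , refl)
SameEdge-sym (inj₂ (refl , refl)) = inj₂ (refl , refl)

SameEdge-trans : ∀ {u v u' v' u'' v''} →
  SameEdge u v u' v' → SameEdge u' v' u'' v'' → SameEdge u v u'' v''
SameEdge-trans (inj₁ (refl , refl)) q                    = q
SameEdge-trans (inj₂ (refl , refl)) (inj₁ (refl , refl)) = inj₂ (refl , refl)
SameEdge-trans (inj₂ (refl , refl)) (inj₂ (refl , refl)) = inj₁ (refl , refl)

SameEdge? : ∀ u v u' v' → Dec (SameEdge u v u' v')
SameEdge? u v u' v' = ((u ≟ u') ×-dec (v ≟ v')) ⊎-dec ((u ≟ v') ×-dec (v ≟ u'))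

SameEdge-end : ∀ {v a b a' b'} → v ≡ a ⊎ v ≡ b → SameEdge a b a' b' → v ≡ a' ⊎ v ≡ b'
SameEdge-end (inj₁ refl) (inj₁ (refl , refl)) = inj₁ refl
SameEdge-end (inj₂ refl) (inj₁ (refl , refl)) = inj₂ refl
SameEdge-end (inj₁ refl) (inj₂ (refl , refl)) = inj₂ refl
SameEdge-end (inj₂ refl) (inj₂ (refl , refl)) = inj₁ refl

SameEdge-∈ : ∀ {P : Vertex → Set} {u v p q} → SameEdge u v p q → P p → P q → P u × P v
SameEdge-∈ (inj₁ (refl , refl)) Pp Pq = Pp , Pq
SameEdge-∈ (inj₂ (refl , refl)) Pp Pq = Pq , Pp

∈⇒∈C : ∀ {z G} → z ∈ G → z ∈C G
∈⇒∈C z∈G = lose z∈G (inj₁ (refl , refl) , refl)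

∈C⇒EdgeIn : ∀ {z G} → z ∈C G → EdgeIn (end₁ z) (end₂ z) G
∈C⇒EdgeIn = Any.map proj₁

EdgeIn-resp : ∀ {a b a' b' G} → SameEdge a b a' b' → EdgeIn a' b' G → EdgeIn a b G
EdgeIn-resp e = Any.map (SameEdge-trans e)

EdgeIn-flip : ∀ {a b G} → EdgeIn a b G → EdgeIn b a G
EdgeIn-flip = EdgeIn-resp (inj₂ (refl , refl))

EdgeIn-mono : ∀ {a b G H} → Subgraph G H → EdgeIn a b G → EdgeIn a b H
EdgeIn-mono G⊆H e with find e
... | z , z∈G , ab≈z = EdgeIn-resp ab≈z (∈C⇒EdgeIn (G⊆H z (∈⇒∈C z∈G)))

∈V-mono : ∀ {v G H} → Subgraph G H → v ∈V G → v ∈V H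
∈V-mono G⊆H v∈ with find v∈
... | z , z∈G , v∈z with find (G⊆H z (∈⇒∈C z∈G))
... | w , w∈H , z≈w , _ = lose w∈H (SameEdge-end v∈z z≈w)

-- Counting colours

dedup : List ℕ → List ℕ
dedup = deduplicate _≟_

length-deduplicate-≤ : ∀ xs → length (dedup xs) ≤ length xs
length-deduplicate-≤ []       = z≤n
length-deduplicate-≤ (x ∷ xs) =
  s≤s (≤-trans (length-filter (¬? ∘ _≟_ x) (dedup xs)) (length-deduplicate-≤ xs))

length-deduplicate-∷ : ∀ x xs → length (dedup (x ∷ xs)) ≤ suc (length (dedup xs))
length-deduplicate-∷ x xs = s≤s (length-filter (¬? ∘ _≟_ x) (dedup xs))

length-deduplicate-∷-∈ : ∀ {x xs} → x ∈ xs → length (dedup (x ∷ xs)) ≤ length (dedup xs)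
length-deduplicate-∷-∈ {x} {xs} x∈xs = filter-notAll (¬? ∘ _≟_ x) (dedup xs)
  (Any.map (λ eq x≢ → x≢ eq) (Equivalence.to (deduplicate-∈⇔ _≟_) x∈xs))

length-deduplicate-unique : ∀ {xs} → Unique xs → length (dedup xs) ≡ length xs
length-deduplicate-unique {[]}     []            = refl
length-deduplicate-unique {x ∷ xs} (x∉xs ∷ uniq) = cong suc (trans
  (cong length (filter-all (¬? ∘ _≟_ x) (AllP.deduplicate⁺ _≟_ x∉xs)))
  (length-deduplicate-unique uniq))

numColors≤length : ∀ G → numColors G ≤ length G
numColors≤length G = ≤-trans (length-deduplicate-≤ (colorList G)) (≤-reflexive (length-map _ G))

numColors-∷ : ∀ z G → numColors (z ∷ G) ≤ suc (numColors G)
numColors-∷ z G = length-deduplicate-∷ (color z) (colorList G)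

numColors-∷-repeated : ∀ {y} z G → y ∈C G → color y ≡ color z → numColors (z ∷ G) ≤ numColors G
numColors-∷-repeated z G y∈G y≡z =
  length-deduplicate-∷-∈ (subst (_∈ colorList G) y≡z (AnyP.map⁺ (Any.map proj₂ y∈G)))

SameEdge-common : ∀ {u v u' v' p q} → SameEdge u v p q → SameEdge u' v' p q → SameEdge u v u' v'
SameEdge-common uv≈pq u'v'≈pq = SameEdge-trans uv≈pq (SameEdge-sym u'v'≈pq)

clash⇒numColors<length : ∀ {x y} G → x ∈C G → y ∈C G → color x ≡ color y → ¬ x ≈ₑ y →
  numColors G < length G
clash⇒numColors<length (z ∷ G) (here (x≈z , _)) (here (y≈z , _)) _ x≉y = ⊥-elim (x≉y (SameEdge-common x≈z y≈z))
clash⇒numColors<length (z ∷ G) (here (_ , x≡z)) (there y∈G) x≡y _ =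
  s≤s (≤-trans (numColors-∷-repeated z G y∈G (trans (sym x≡y) x≡z)) (numColors≤length G))
clash⇒numColors<length (z ∷ G) (there x∈G) (here (_ , y≡z)) x≡y _ =
  s≤s (≤-trans (numColors-∷-repeated z G x∈G (trans x≡y y≡z)) (numColors≤length G))
clash⇒numColors<length (z ∷ G) (there x∈G) (there y∈G) x≡y x≉y =
  s≤s (≤-trans (numColors-∷ z G) (clash⇒numColors<length G x∈G y∈G x≡y x≉y))

repeatedHead+clash : ∀ {y} z G → y ∈C G → color y ≡ color z → numColors G < length G →
  2 + numColors (z ∷ G) ≤ length (z ∷ G)
repeatedHead+clash z G y∈G y≡z clash = s≤s (≤-trans (s≤s (numColors-∷-repeated z G y∈G y≡z)) clash)

twoClashes⇒2+numColors≤length : ∀ {x y x' y'} G → x ∈C G → y ∈C G → x' ∈C G → y' ∈C G →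
  color x ≡ color y → color x' ≡ color y' →
  AllPairs (λ e f → ¬ e ≈ₑ f) (x ∷ y ∷ x' ∷ y' ∷ []) →
  2 + numColors G ≤ length G
twoClashes⇒2+numColors≤length (z ∷ G) (here (x≈z , _)) (here (y≈z , _)) _ _ _ _
  ((x≉y ∷ _) ∷ _) = ⊥-elim (x≉y (SameEdge-common x≈z y≈z))
twoClashes⇒2+numColors≤length (z ∷ G) (here (x≈z , _)) (there _) (here (x'≈z , _)) _ _ _
  ((_ ∷ x≉x' ∷ _) ∷ _) = ⊥-elim (x≉x' (SameEdge-common x≈z x'≈z))
twoClashes⇒2+numColors≤length (z ∷ G) (here (x≈z , _)) (there _) (there _) (here (y'≈z , _)) _ _
  ((_ ∷ _ ∷ x≉y' ∷ _) ∷ _) = ⊥-elim (x≉y' (SameEdge-common x≈z y'≈z))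
twoClashes⇒2+numColors≤length (z ∷ G) (here (_ , x≡z)) (there y∈G) (there x'∈G) (there y'∈G) x≡y x'≡y'
  (_ ∷ _ ∷ (x'≉y' ∷ []) ∷ _) =
  repeatedHead+clash z G y∈G (trans (sym x≡y) x≡z) (clash⇒numColors<length G x'∈G y'∈G x'≡y' x'≉y')
twoClashes⇒2+numColors≤length (z ∷ G) (there _) (here (y≈z , _)) (here (x'≈z , _)) _ _ _
  (_ ∷ (y≉x' ∷ _) ∷ _) = ⊥-elim (y≉x' (SameEdge-common y≈z x'≈z))
twoClashes⇒2+numColors≤length (z ∷ G) (there _) (here (y≈z , _)) (there _) (here (y'≈z , _)) _ _
  (_ ∷ (_ ∷ y≉y' ∷ _) ∷ _) = ⊥-elim (y≉y' (SameEdge-common y≈z y'≈z))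
twoClashes⇒2+numColors≤length (z ∷ G) (there x∈G) (here (_ , y≡z)) (there x'∈G) (there y'∈G) x≡y x'≡y'
  (_ ∷ _ ∷ (x'≉y' ∷ []) ∷ _) =
  repeatedHead+clash z G x∈G (trans x≡y y≡z) (clash⇒numColors<length G x'∈G y'∈G x'≡y' x'≉y')
twoClashes⇒2+numColors≤length (z ∷ G) (there _) (there _) (here (x'≈z , _)) (here (y'≈z , _)) _ _
  (_ ∷ _ ∷ (x'≉y' ∷ []) ∷ _) = ⊥-elim (x'≉y' (SameEdge-common x'≈z y'≈z))
twoClashes⇒2+numColors≤length (z ∷ G) (there x∈G) (there y∈G) (here (_ , x'≡z)) (there y'∈G) x≡y x'≡y'
  ((x≉y ∷ _) ∷ _) =
  repeatedHead+clash z G y'∈G (trans (sym x'≡y') x'≡z) (clash⇒numColors<length G x∈G y∈G x≡y x≉y)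
twoClashes⇒2+numColors≤length (z ∷ G) (there x∈G) (there y∈G) (there x'∈G) (here (_ , y'≡z)) x≡y x'≡y'
  ((x≉y ∷ _) ∷ _) =
  repeatedHead+clash z G x'∈G (trans x'≡y' y'≡z) (clash⇒numColors<length G x∈G y∈G x≡y x≉y)
twoClashes⇒2+numColors≤length (z ∷ G) (there x∈G) (there y∈G) (there x'∈G) (there y'∈G) x≡y x'≡y' distinct =
  s≤s (≤-trans (s≤s (numColors-∷ z G))
    (twoClashes⇒2+numColors≤length G x∈G y∈G x'∈G y'∈G x≡y x'≡y' distinct))

rainbow-sameColor⇒≈ₑ : ∀ {x y} G → Rainbow G → x ∈C G → y ∈C G → color x ≡ color y → x ≈ₑ y
rainbow-sameColor⇒≈ₑ {x} {y} G rainbow x∈G y∈G x≡y with SameEdge? (end₁ x) (end₂ x) (end₁ y) (end₂ y)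
... | yes x≈y = x≈y
... | no  x≉y = ⊥-elim (<-irrefl rainbow (clash⇒numColors<length G x∈G y∈G x≡y x≉y))

-- Vertex paths

route : Vertex → List Vertex → Vertex → List Vertex
route a m b = a ∷ m ++ b ∷ []

Consecutive : List Vertex → Vertex → Vertex → Set
Consecutive ys a b = (a , b) ∈ consecutive ys

last-route : ∀ a m b → last (route a m b) ≡ just b
last-route a []      b = refl
last-route a (x ∷ m) b = last-route x m b

2≤length-route : ∀ a m b → 2 ≤ length (route a m b)
2≤length-route a []      b = s≤s (s≤s z≤n)
2≤length-route a (x ∷ m) b = s≤s (s≤s z≤n)

last∈route : ∀ a m b → b ∈ route a m b
last∈route a m b = there (AnyP.++⁺ʳ m (here refl))

reverse-route : ∀ a m b → reverse (route a m b) ≡ route b (reverse m) a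
reverse-route a m b = trans (unfold-reverse a (m ++ b ∷ [])) (cong (_++ a ∷ []) (reverse-++ m (b ∷ [])))

head-last⇒route : ∀ {s t} xs → head xs ≡ just s → last xs ≡ just t → 2 ≤ length xs →
  ∃ λ m → xs ≡ route s m t
head-last⇒route (x ∷ [])         _    _  (s≤s ())
head-last⇒route (x ∷ y ∷ [])     refl refl _ = [] , refl
head-last⇒route (x ∷ y ∷ z ∷ r) refl ≡t _ with head-last⇒route (y ∷ z ∷ r) refl ≡t (s≤s (s≤s z≤n))
... | m , eq = y ∷ m , cong (x ∷_) eq

Consecutive-++ʳ : ∀ {a b} xs y zs → Consecutive (y ∷ zs) a b → Consecutive (xs ++ y ∷ zs) a b
Consecutive-++ʳ []            y zs c = c
Consecutive-++ʳ (x ∷ [])      y zs c = there c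
Consecutive-++ʳ (x ∷ x' ∷ xs) y zs c = there (Consecutive-++ʳ (x' ∷ xs) y zs c)

Consecutive-++ˡ : ∀ {a b} xs zs → Consecutive xs a b → Consecutive (xs ++ zs) a b
Consecutive-++ˡ (x ∷ x' ∷ xs) zs (here ab≡) = here ab≡
Consecutive-++ˡ (x ∷ x' ∷ xs) zs (there c)  = there (Consecutive-++ˡ (x' ∷ xs) zs c)

Consecutive-++⁻ : ∀ {a b} xs y zs → Consecutive (xs ++ y ∷ zs) a b →
  Consecutive (xs ++ y ∷ []) a b ⊎ Consecutive (y ∷ zs) a b
Consecutive-++⁻ []            y zs c            = inj₂ c
Consecutive-++⁻ (x ∷ [])      y zs (here ab≡)   = inj₁ (here ab≡)
Consecutive-++⁻ (x ∷ [])      y zs (there c)    = inj₂ c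
Consecutive-++⁻ (x ∷ x' ∷ xs) y zs (here ab≡)   = inj₁ (here ab≡)
Consecutive-++⁻ (x ∷ x' ∷ xs) y zs (there c)    = Sum.map₁ there (Consecutive-++⁻ (x' ∷ xs) y zs c)

Consecutive⇒∈ : ∀ {a b} ys → Consecutive ys a b → a ∈ ys × b ∈ ys
Consecutive⇒∈ (x ∷ x' ∷ ys) (here refl) = here refl , there (here refl)
Consecutive⇒∈ (x ∷ x' ∷ ys) (there c)   = Product.map there there (Consecutive⇒∈ (x' ∷ ys) c)

Consecutive-reverse : ∀ {a b} ys → Consecutive ys a b → Consecutive (reverse ys) b a
Consecutive-reverse (x ∷ x' ∷ ys) (here refl)
  rewrite unfold-reverse x (x' ∷ ys) | unfold-reverse x' ys | ++-assoc (reverse ys) (x' ∷ []) (x ∷ [])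
  = Consecutive-++ʳ (reverse ys) x' (x ∷ []) (here refl)
Consecutive-reverse (x ∷ x' ∷ ys) (there c) rewrite unfold-reverse x (x' ∷ ys)
  = Consecutive-++ˡ (reverse (x' ∷ ys)) (x ∷ []) (Consecutive-reverse (x' ∷ ys) c)

Consecutive-cast : ∀ {xs ys a b} → xs ≡ ys → Consecutive xs a b → Consecutive ys a b
Consecutive-cast refl c = c

Consecutive-reverse⁻ : ∀ {a b} ys → Consecutive (reverse ys) a b → Consecutive ys b a
Consecutive-reverse⁻ ys c = Consecutive-cast (reverse-involutive ys) (Consecutive-reverse (reverse ys) c)

Unique-++ˡ : ∀ {A : Set} (xs : List A) {ys} → Unique (xs ++ ys) → Unique xs
Unique-++ˡ []       _           = []
Unique-++ˡ (x ∷ xs) (x∉ ∷ uniq) = AllP.++⁻ˡ xs x∉ ∷ Unique-++ˡ xs uniq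

Unique-++ʳ : ∀ {A : Set} (xs : List A) {ys} → Unique (xs ++ ys) → Unique ys
Unique-++ʳ []       uniq       = uniq
Unique-++ʳ (x ∷ xs) (_ ∷ uniq) = Unique-++ʳ xs uniq

Unique-++-disjoint : ∀ {A : Set} (xs : List A) {ys v} → Unique (xs ++ ys) → v ∈ xs → v ∉ ys
Unique-++-disjoint (x ∷ xs) uniq (here refl) v∈ys = Unique[x∷xs]⇒x∉xs uniq (AnyP.++⁺ʳ xs v∈ys)
Unique-++-disjoint (x ∷ xs) (_ ∷ uniq) (there v∈xs) = Unique-++-disjoint xs uniq v∈xs

Unique-reverse : ∀ {A : Set} {xs : List A} → Unique xs → Unique (reverse xs)
Unique-reverse {xs = []}     []          = []
Unique-reverse {xs = x ∷ xs} (x∉ ∷ uniq) rewrite unfold-reverse x xs =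
  UniqueP.++⁺ (Unique-reverse uniq) ([] ∷ [])
    λ { (v∈ , here refl) → Unique[x∷xs]⇒x∉xs (x∉ ∷ uniq) (AnyP.reverse⁻ v∈) }

record VPath (G : CGraph) (a b : Vertex) : Set where
  field
    inner  : List Vertex
    unique : Unique (route a inner b)
    edge   : ∀ {p q} → Consecutive (route a inner b) p q → EdgeIn p q G

  vertices : List Vertex
  vertices = route a inner b

open VPath

VPath-reverse : ∀ {G a b} → VPath G a b → VPath G b a
VPath-reverse {a = a} {b} π = record
  { inner  = reverse (inner π)
  ; unique = subst Unique (reverse-route a (inner π) b) (Unique-reverse (unique π))
  ; edge   = λ c → EdgeIn-flip (edge π (Consecutive-reverse⁻ (vertices π)
                     (Consecutive-cast (sym (reverse-route a (inner π) b)) c)))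
  }

∈-VPath-reverse : ∀ {G a b u} (π : VPath G a b) → u ∈ vertices (VPath-reverse π) → u ∈ vertices π
∈-VPath-reverse {a = a} {b} {u} π u∈ =
  AnyP.reverse⁻ (subst (u ∈_) (sym (reverse-route a (inner π) b)) u∈)

route-++ : ∀ v C w (E : List Vertex) → route v C w ++ E ≡ v ∷ C ++ w ∷ E
route-++ v C w E = cong (v ∷_) (++-assoc C (w ∷ []) E)

module _ {G a b} (π : VPath G a b) (A : List Vertex) (v : Vertex) (C : List Vertex) (w : Vertex)
         (E : List Vertex) (π≡ : vertices π ≡ A ++ v ∷ C ++ w ∷ E) where

  segment : VPath G v w
  segment = record
    { inner  = C
    ; unique = Unique-++ˡ (route v C w)
                 (subst Unique (sym (route-++ v C w E)) (Unique-++ʳ A (subst Unique π≡ (unique π))))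
    ; edge   = λ c → edge π (Consecutive-cast (sym π≡) (Consecutive-++ʳ A v (C ++ w ∷ E)
                 (Consecutive-cast (route-++ v C w E) (Consecutive-++ˡ (route v C w) E c))))
    }

  ∈-segment : ∀ {u} → u ∈ vertices segment → u ∈ vertices π
  ∈-segment {u} u∈ =
    subst (u ∈_) (sym π≡) (AnyP.++⁺ʳ A (subst (u ∈_) (route-++ v C w E) (AnyP.++⁺ˡ u∈)))

∈-∈-decompose : ∀ {V : Set} {v w : V} xs → v ∈ xs → w ∈ xs → v ≢ w →
  Σ (List V × List V × List V) λ (A , C , E) →
    xs ≡ A ++ v ∷ C ++ w ∷ E ⊎ xs ≡ A ++ w ∷ C ++ v ∷ E
∈-∈-decompose {v = v} {w} xs v∈ w∈ v≢w with ∈-∃++ v∈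
... | A , R , refl with AnyP.++⁻ A w∈
...   | inj₂ (here w≡v) = ⊥-elim (v≢w (sym w≡v))
...   | inj₂ (there w∈R) with ∈-∃++ w∈R
...     | C , E , refl = (A , C , E) , inj₁ refl
∈-∈-decompose {v = v} {w} xs v∈ w∈ v≢w | A , R , refl | inj₁ w∈A with ∈-∃++ w∈A
...   | A₁ , A₂ , refl = (A₁ , A₂ , R) , inj₂ (++-assoc A₁ (w ∷ A₂) (v ∷ R))

subpath : ∀ {G a b v w} (π : VPath G a b) → v ∈ vertices π → w ∈ vertices π → v ≢ w → VPath G v w
subpath {v = v} {w} π v∈ w∈ v≢w with ∈-∈-decompose (vertices π) v∈ w∈ v≢w
... | (A , C , E) , inj₁ π≡ = segment π A v C w E π≡
... | (A , C , E) , inj₂ π≡ = VPath-reverse (segment π A w C v E π≡)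

record Split {G s t} (π : VPath G s t) (v : Vertex) : Set where
  field
    before   : VPath G s v
    after    : VPath G v t
    meet     : ∀ {u} → u ∈ vertices before → u ∈ vertices after → u ≡ v
    ∈-before : ∀ {u} → u ∈ vertices before → u ∈ vertices π
    ∈-after  : ∀ {u} → u ∈ vertices after → u ∈ vertices π

split : ∀ {G s t v} (π : VPath G s t) → v ∈ vertices π → v ≢ s → v ≢ t → Split π v
split π (here v≡s) v≢s _ = ⊥-elim (v≢s v≡s)
split {s = s} {t} {v} π (there v∈) v≢s v≢t with AnyP.++⁻ (inner π) v∈
... | inj₂ (here v≡t) = ⊥-elim (v≢t v≡t)
... | inj₁ v∈inner with ∈-∃++ v∈inner
...   | a , b , inner≡ = record
  { before   = segment π [] s a v (b ++ t ∷ []) π≡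
  ; after    = segment π (s ∷ a) v b t [] π≡
  ; meet     = meet
  ; ∈-before = ∈-segment π [] s a v (b ++ t ∷ []) π≡
  ; ∈-after  = ∈-segment π (s ∷ a) v b t [] π≡
  }
  where
  π≡ : vertices π ≡ s ∷ a ++ v ∷ b ++ t ∷ []
  π≡ = trans (cong (λ m → s ∷ m ++ t ∷ []) inner≡) (cong (s ∷_) (++-assoc a (v ∷ b) (t ∷ [])))
  meet : ∀ {u} → u ∈ route s a v → u ∈ route v b t → u ≡ v
  meet u∈before u∈after with AnyP.++⁻ (s ∷ a) u∈before
  ... | inj₁ u∈sa      = ⊥-elim (Unique-++-disjoint (s ∷ a) (subst Unique π≡ (unique π)) u∈sa u∈after)
  ... | inj₂ (here u≡v) = u≡v

OnRoute : List Vertex → CEdge → Set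
OnRoute ys z = Any (λ (p , q) → SameEdge (end₁ z) (end₂ z) p q) (consecutive ys)

OnRoute? : ∀ ys z → Dec (OnRoute ys z)
OnRoute? ys z = any? (λ (p , q) → SameEdge? (end₁ z) (end₂ z) p q) (consecutive ys)

RainbowPathIn : CGraph → Vertex → Vertex → Set
RainbowPathIn B a b = Σ CGraph (λ H → Subgraph H B × IsPath H a b × Rainbow H)

record Clash (B : CGraph) (ys : List Vertex) : Set where
  field
    {x y}     : CEdge
    x∈B       : x ∈ B
    y∈B       : y ∈ B
    x-on      : OnRoute ys x
    y-on      : OnRoute ys y
    sameColor : color x ≡ color y
    different : ¬ x ≈ₑ y

allPairs-or-witness : ∀ {A : Set} {R S : A → A → Set} → (∀ x y → Dec (R x y)) →
  ∀ {xs} → AllPairs S xs → AllPairs (λ x y → ¬ R x y) xs ⊎ ∃₂ λ x y → x ∈ xs × y ∈ xs × S x y × R x y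
allPairs-or-witness R? []                      = inj₁ []
allPairs-or-witness R? {x ∷ xs} (Sx ∷ Sxs) with any? (R? x) xs
... | yes Rx with find Rx
...   | y , y∈xs , Rxy = inj₂ (x , y , here refl , there y∈xs , All.lookup Sx y∈xs , Rxy)
allPairs-or-witness R? {x ∷ xs} (Sx ∷ Sxs) | no ¬Rx with allPairs-or-witness R? Sxs
... | inj₁ ¬Rxs                          = inj₁ (AllP.¬Any⇒All¬ xs ¬Rx ∷ ¬Rxs)
... | inj₂ (y , z , y∈ , z∈ , Syz , Ryz) = inj₂ (y , z , there y∈ , there z∈ , Syz , Ryz)

rainbowPath-or-clash : ∀ {B a b} → WellFormed B → (π : VPath B a b) → RainbowPathIn B a b ⊎ Clash B (vertices π)
rainbowPath-or-clash {B} {a} {b} (loopless , simple) π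
  with allPairs-or-witness (λ x y → color x ≟ color y) (AllPairsP.filter⁺ (OnRoute? (vertices π)) simple)
... | inj₁ distinctColors = inj₁ (H , H⊆B , isPath , rainbow)
  where
  H = filter (OnRoute? (vertices π)) B
  H⊆B : Subgraph H B
  H⊆B _ = AnyP.filter⁻ (OnRoute? (vertices π))
  edgeInH : ∀ {(p , q) : Vertex × Vertex} → Consecutive (vertices π) p q → EdgeIn p q H
  edgeInH c with find (edge π c)
  ... | z , z∈B , pq≈z = lose (∈-filter⁺ (OnRoute? (vertices π)) z∈B (lose c (SameEdge-sym pq≈z))) pq≈z
  isPath : IsPath H a b
  isPath = (AllP.filter⁺ (OnRoute? (vertices π)) loopless , AllPairsP.filter⁺ (OnRoute? (vertices π)) simple)
         , vertices π , unique π , 2≤length-route a (inner π) b , refl , last-route a (inner π) b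
         , All.tabulate edgeInH , AllP.all-filter (OnRoute? (vertices π)) B
  rainbow : Rainbow H
  rainbow = trans (length-deduplicate-unique (AllPairsP.map⁺ distinctColors)) (length-map color H)
... | inj₂ (x , y , x∈H , y∈H , x≉y , x≡y)
  with ∈-filter⁻ (OnRoute? (vertices π)) x∈H | ∈-filter⁻ (OnRoute? (vertices π)) y∈H
...   | x∈B , x-on | y∈B , y-on = inj₂ record
  { x∈B = x∈B ; y∈B = y∈B ; x-on = x-on ; y-on = y-on ; sameColor = x≡y ; different = x≉y }

VPath-mono : ∀ {G H a b} → Subgraph G H → VPath G a b → VPath H a b
VPath-mono G⊆H π = record { inner = inner π ; unique = unique π ; edge = EdgeIn-mono G⊆H ∘ edge π }

Side : CGraph → List Vertex → CEdge → Set
Side G L z = EdgeIn (end₁ z) (end₂ z) G × end₁ z ∈ L × end₂ z ∈ L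

consecutive⇒Side : ∀ {G a b z p q} (π : VPath G a b) → Consecutive (vertices π) p q →
  SameEdge (end₁ z) (end₂ z) p q → Side G (vertices π) z
consecutive⇒Side π c z≈pq with Consecutive⇒∈ (vertices π) c
... | p∈ , q∈ = EdgeIn-resp z≈pq (edge π c) , SameEdge-∈ z≈pq p∈ q∈

onRoute⇒Side : ∀ {G a b z} (π : VPath G a b) → OnRoute (vertices π) z → Side G (vertices π) z
onRoute⇒Side {z = z} π on with find on
... | _ , c , z≈pq = consecutive⇒Side {z = z} π c z≈pq

∈route⇒consecutive : ∀ {v} a m b → v ∈ route a m b →
  ∃₂ λ p q → Consecutive (route a m b) p q × (v ≡ p ⊎ v ≡ q)
∈route⇒consecutive a []      b (here v≡a)         = a , b , here refl , inj₁ v≡a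
∈route⇒consecutive a []      b (there (here v≡b)) = a , b , here refl , inj₂ v≡b
∈route⇒consecutive a (x ∷ m) b (here v≡a)         = a , x , here refl , inj₁ v≡a
∈route⇒consecutive a (x ∷ m) b (there v∈)         with ∈route⇒consecutive x m b v∈
... | p , q , c , v≡pq = p , q , there c , v≡pq

-- Branches of a theta graph

record Branch (B P : CGraph) (s t : Vertex) : Set where
  field
    path      : VPath P s t
    ∈V⇒∈path  : ∀ {v} → v ∈V P → v ∈ vertices path
    ∈path⇒∈V  : ∀ {v} → v ∈ vertices path → v ∈V P
    P⊆B       : Subgraph P B
    owns      : ∀ {z} → z ∈ B → EdgeIn (end₁ z) (end₂ z) P → z ∈C P
    rainbow   : Rainbow P

isPath⇒Branch : ∀ {B P s t} → IsPath P s t → Rainbow P → Subgraph P B →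
  (∀ {z} → z ∈ B → EdgeIn (end₁ z) (end₂ z) P → z ∈C P) → Branch B P s t
isPath⇒Branch {P = P} {s} {t} (_ , xs , uniq , 2≤ , head≡ , last≡ , edges , covered) rainbow P⊆B owns
  with head-last⇒route xs head≡ last≡ 2≤
... | m , refl = record
  { path     = record { inner = m ; unique = uniq ; edge = All.lookup edges }
  ; ∈V⇒∈path = ∈V⇒∈path
  ; ∈path⇒∈V = ∈path⇒∈V
  ; P⊆B      = P⊆B
  ; owns     = owns
  ; rainbow  = rainbow
  }
  where
  ∈V⇒∈path : ∀ {v} → v ∈V P → v ∈ route s m t
  ∈V⇒∈path v∈ with find v∈
  ... | z , z∈P , v∈z with find (All.lookup covered z∈P)
  ... | (p , q) , c , z≈pq with Consecutive⇒∈ (route s m t) c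
  ... | p∈ , q∈ with SameEdge-∈ z≈pq p∈ q∈
  ... | u∈ , w∈ = Sum.[ (λ { refl → u∈ }) , (λ { refl → w∈ }) ] v∈z
  ∈path⇒∈V : ∀ {v} → v ∈ route s m t → v ∈V P
  ∈path⇒∈V v∈ with ∈route⇒consecutive s m t v∈
  ... | p , q , c , v≡pq with find (All.lookup edges c)
  ... | z , z∈P , pq≈z = lose z∈P (SameEdge-end v≡pq pq≈z)

module _ {B P s t} (X : Branch B P s t) where
  open Branch X

  Branch-sameColor⇒≈ₑ : ∀ {x y} → x ∈ B → y ∈ B → EdgeIn (end₁ x) (end₂ x) P → EdgeIn (end₁ y) (end₂ y) P →
    color x ≡ color y → x ≈ₑ y
  Branch-sameColor⇒≈ₑ x∈B y∈B x∈P y∈P = rainbow-sameColor⇒≈ₑ P rainbow (owns x∈B x∈P) (owns y∈B y∈P)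

module _ {B P s t} (wf : WellFormed B) (X : Branch B P s t) where
  open Branch X

  rainbowPath-alongBranch : ∀ {v w} → VPath P v w → RainbowPathIn B v w
  rainbowPath-alongBranch σ with rainbowPath-or-clash wf (VPath-mono P⊆B σ)
  ... | inj₁ found = found
  ... | inj₂ clash =
    ⊥-elim (different (Branch-sameColor⇒≈ₑ X x∈B y∈B (side {x} x-on) (side {y} y-on) sameColor))
    where
    open Clash clash
    side : ∀ {z} → OnRoute (vertices σ) z → EdgeIn (end₁ z) (end₂ z) P
    side {z} on = proj₁ (onRoute⇒Side {z = z} σ on)

  rainbowPath-withinBranch : ∀ {v w} → v ∈ vertices path → w ∈ vertices path → v ≢ w → RainbowPathIn B v w
  rainbowPath-withinBranch v∈ w∈ v≢w = rainbowPath-alongBranch (subpath path v∈ w∈ v≢w)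

module _ {G H a w b} (S : VPath G a w) (T : VPath H w b)
         (meet : ∀ {u} → u ∈ vertices S → u ∈ vertices T → u ≡ w) where

  private
    join≡ : route a (inner S ++ w ∷ inner T) b ≡ a ∷ inner S ++ w ∷ inner T ++ b ∷ []
    join≡ = cong (a ∷_) (++-assoc (inner S) (w ∷ inner T) (b ∷ []))

  Consecutive-join⁻ : ∀ {p q} → Consecutive (route a (inner S ++ w ∷ inner T) b) p q →
    Consecutive (vertices S) p q ⊎ Consecutive (vertices T) p q
  Consecutive-join⁻ c = Consecutive-++⁻ (a ∷ inner S) w (inner T ++ b ∷ []) (Consecutive-cast join≡ c)

  VPath-join : VPath (G ++ H) a b
  VPath-join = record
    { inner  = inner S ++ w ∷ inner T
    ; unique = subst Unique (trans (route-++ a (inner S) w (inner T ++ b ∷ [])) (sym join≡))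
                 (UniqueP.++⁺ (unique S) (Unique-++ʳ (w ∷ []) (unique T)) disjoint)
    ; edge   = Sum.[ AnyP.++⁺ˡ ∘ edge S , AnyP.++⁺ʳ G ∘ edge T ] ∘ Consecutive-join⁻
    }
    where
    disjoint : ∀ {u} → u ∈ vertices S × u ∈ inner T ++ b ∷ [] → ⊥
    disjoint (u∈S , u∈T) with meet u∈S (there u∈T)
    ... | refl = Unique[x∷xs]⇒x∉xs (unique T) u∈T

record CrossClash (B P Q : CGraph) (L L' : List Vertex) : Set where
  field
    {e f}     : CEdge
    e∈B       : e ∈ B
    f∈B       : f ∈ B
    sameColor : color e ≡ color f
    e-side    : Side P L e
    f-side    : Side Q L' f

module _ {B P Q s t s' t'} (wf : WellFormed B) (X : Branch B P s t) (Y : Branch B Q s' t') where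

  P++Q⊆B : Subgraph (P ++ Q) B
  P++Q⊆B z z∈ = Sum.[ Branch.P⊆B X z , Branch.P⊆B Y z ] (AnyP.++⁻ P z∈)

  rainbowPath-or-crossClash : ∀ {a w b} (S : VPath P a w) (T : VPath Q w b) →
    (∀ {u} → u ∈ vertices S → u ∈ vertices T → u ≡ w) →
    RainbowPathIn B a b ⊎ CrossClash B P Q (vertices S) (vertices T)
  rainbowPath-or-crossClash {a} {w} {b} S T meet
    with rainbowPath-or-clash wf (VPath-mono P++Q⊆B (VPath-join S T meet))
  ... | inj₁ found = inj₁ found
  ... | inj₂ clash = inj₂ (crossing (side {x} x-on) (side {y} y-on))
    where
    open Clash clash
    side : ∀ {z} → OnRoute (route a (inner S ++ w ∷ inner T) b) z → Side P (vertices S) z ⊎ Side Q (vertices T) z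
    side {z} on with find on
    ... | _ , c , z≈pq = Sum.map (λ cS → consecutive⇒Side {z = z} S cS z≈pq)
                                 (λ cT → consecutive⇒Side {z = z} T cT z≈pq)
                                 (Consecutive-join⁻ S T meet c)
    crossing : Side P (vertices S) x ⊎ Side Q (vertices T) x → Side P (vertices S) y ⊎ Side Q (vertices T) y →
      CrossClash B P Q (vertices S) (vertices T)
    crossing (inj₁ xP) (inj₁ yP) =
      ⊥-elim (different (Branch-sameColor⇒≈ₑ X x∈B y∈B (proj₁ xP) (proj₁ yP) sameColor))
    crossing (inj₂ xQ) (inj₂ yQ) =
      ⊥-elim (different (Branch-sameColor⇒≈ₑ Y x∈B y∈B (proj₁ xQ) (proj₁ yQ) sameColor))
    crossing (inj₁ xP) (inj₂ yQ) = record
      { e∈B = x∈B ; f∈B = y∈B ; sameColor = sameColor ; e-side = xP ; f-side = yQ }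
    crossing (inj₂ xQ) (inj₁ yP) = record
      { e∈B = y∈B ; f∈B = x∈B ; sameColor = sym sameColor ; e-side = yP ; f-side = xQ }

≉-acrossMeet : ∀ {G G' L L' v e f} → end₁ e ≢ end₂ e → (∀ {u} → u ∈ L → u ∈ L' → u ≡ v) →
  Side G L e → Side G' L' f → ¬ e ≈ₑ f
≉-acrossMeet loopless meet (_ , e₁∈L , e₂∈L) (_ , f₁∈L' , f₂∈L') e≈f with SameEdge-∈ e≈f f₁∈L' f₂∈L'
... | e₁∈L' , e₂∈L' = loopless (trans (meet e₁∈L e₁∈L') (sym (meet e₂∈L e₂∈L')))

module _ {B P Q : CGraph} (noCommonEdge : ∀ u v → EdgeIn u v P → EdgeIn u v Q → ⊥) where

  ≉-acrossBranches : ∀ {e f L L'} → Side P L e → Side Q L' f → ¬ e ≈ₑ f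
  ≉-acrossBranches (e∈P , _) (f∈Q , _) e≈f = noCommonEdge _ _ e∈P (EdgeIn-resp e≈f f∈Q)

  twoCrossClashes-absurd : ∀ {S₁ S₂ T₁ T₂ v v'} → WellFormed B → AlmostRainbow B →
    CrossClash B P Q S₁ S₂ → CrossClash B P Q T₁ T₂ →
    (∀ {u} → u ∈ S₁ → u ∈ T₁ → u ≡ v) → (∀ {u} → u ∈ S₂ → u ∈ T₂ → u ≡ v') → ⊥
  twoCrossClashes-absurd (loopless , _) almostRainbow c₁ c₂ meetP meetQ =
    <-irrefl refl (≤-trans twoClashes (≤-reflexive (trans (sym almostRainbow) (+-comm (numColors B) 1))))
    where
    module C₁ = CrossClash c₁
    module C₂ = CrossClash c₂
    twoClashes : 2 + numColors B ≤ length B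
    twoClashes = twoClashes⇒2+numColors≤length B (∈⇒∈C C₁.e∈B) (∈⇒∈C C₁.f∈B) (∈⇒∈C C₂.e∈B) (∈⇒∈C C₂.f∈B)
      C₁.sameColor C₂.sameColor
      ( (≉-acrossBranches {C₁.e} {C₁.f} C₁.e-side C₁.f-side
        ∷ ≉-acrossMeet {e = C₁.e} {C₂.e} (All.lookup loopless C₁.e∈B) meetP C₁.e-side C₂.e-side
        ∷ ≉-acrossBranches {C₁.e} {C₂.f} C₁.e-side C₂.f-side ∷ [])
      ∷ (≉-acrossBranches {C₂.e} {C₁.f} C₂.e-side C₁.f-side ∘ SameEdge-sym
        ∷ ≉-acrossMeet {e = C₁.f} {C₂.f} (All.lookup loopless C₁.f∈B) meetQ C₁.f-side C₂.f-side ∷ [])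
      ∷ (≉-acrossBranches {C₂.e} {C₂.f} C₂.e-side C₂.f-side ∷ [])
      ∷ [] ∷ [])

module _ {B P Q s t} (wf : WellFormed B) (almostRainbow : AlmostRainbow B)
         (X : Branch B P s t) (Y : Branch B Q s t) (shared : SharesExactlyTerminals P Q s t) where
  private
    module X = Branch X
    module Y = Branch Y

    common : ∀ {u} → u ∈ vertices X.path → u ∈ vertices Y.path → u ≡ s ⊎ u ≡ t
    common u∈X u∈Y = proj₁ shared _ (X.∈path⇒∈V u∈X) (Y.∈path⇒∈V u∈Y)

  module _ {v₁ v₂} (v₁∈X : v₁ ∈ vertices X.path) (v₁∉Y : v₁ ∉ vertices Y.path)
                   (v₂∈Y : v₂ ∈ vertices Y.path) (v₂∉X : v₂ ∉ vertices X.path) where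
    private
      SX : Split X.path v₁
      SX = split X.path v₁∈X (λ { refl → v₁∉Y (here refl) }) (λ { refl → v₁∉Y (last∈route s (inner Y.path) t) })
      SY : Split Y.path v₂
      SY = split Y.path v₂∈Y (λ { refl → v₂∉X (here refl) }) (λ { refl → v₂∉X (last∈route s (inner X.path) t) })
      module SX = Split SX
      module SY = Split SY

      meetₛ : ∀ {u} → u ∈ vertices (VPath-reverse SX.before) → u ∈ vertices SY.before → u ≡ s
      meetₛ u∈SX u∈SY with common (SX.∈-before (∈-VPath-reverse SX.before u∈SX)) (SY.∈-before u∈SY)
      ... | inj₁ u≡s = u≡s
      ... | inj₂ refl = ⊥-elim (v₁∉Y (subst (_∈ vertices Y.path)
              (SX.meet (∈-VPath-reverse SX.before u∈SX) (last∈route v₁ (inner SX.after) t))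
              (last∈route s (inner Y.path) t)))

      meetₜ : ∀ {u} → u ∈ vertices SX.after → u ∈ vertices (VPath-reverse SY.after) → u ≡ t
      meetₜ u∈SX u∈SY with common (SX.∈-after u∈SX) (SY.∈-after (∈-VPath-reverse SY.after u∈SY))
      ... | inj₂ u≡t = u≡t
      ... | inj₁ refl = ⊥-elim (v₁∉Y (subst (_∈ vertices Y.path) (SX.meet (here refl) u∈SX) (here refl)))

    rainbowPath-acrossInteriors : RainbowPathIn B v₁ v₂
    rainbowPath-acrossInteriors
      with rainbowPath-or-crossClash wf X Y (VPath-reverse SX.before) SY.before meetₛ
         | rainbowPath-or-crossClash wf X Y SX.after (VPath-reverse SY.after) meetₜ
    ... | inj₁ throughS | _              = throughS
    ... | inj₂ _        | inj₁ throughT = throughT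
    ... | inj₂ clashₛ   | inj₂ clashₜ   = ⊥-elim (twoCrossClashes-absurd (proj₂ shared) wf almostRainbow clashₛ clashₜ
            (SX.meet ∘ ∈-VPath-reverse SX.before) (λ u∈ → SY.meet u∈ ∘ ∈-VPath-reverse SY.after))

  rainbowPath-acrossBranches : ∀ {v₁ v₂} → v₁ ∈ vertices X.path → v₂ ∈ vertices Y.path → v₁ ≢ v₂ →
    RainbowPathIn B v₁ v₂
  rainbowPath-acrossBranches {v₁} {v₂} v₁∈X v₂∈Y v₁≢v₂ with v₂ ∈? vertices X.path | v₁ ∈? vertices Y.path
  ... | yes v₂∈X | _        = rainbowPath-withinBranch wf X v₁∈X v₂∈X v₁≢v₂
  ... | no _     | yes v₁∈Y = rainbowPath-withinBranch wf Y v₁∈Y v₂∈Y v₁≢v₂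
  ... | no v₂∉X  | no v₁∉Y  = rainbowPath-acrossInteriors v₁∈X v₁∉Y v₂∈Y v₂∉X

SharesExactlyTerminals-sym : ∀ {P Q s t} → SharesExactlyTerminals P Q s t → SharesExactlyTerminals Q P s t
SharesExactlyTerminals-sym (sharedVertex , sharedEdge) =
  (λ v v∈Q v∈P → sharedVertex v v∈P v∈Q) , (λ u v uv∈Q uv∈P → sharedEdge u v uv∈P uv∈Q)

record Theta (B : CGraph) : Set where
  field
    s t      : Vertex
    paths    : Fin 3 → CGraph
    branch   : ∀ i → Branch B (paths i) s t
    separate : ∀ {i j} → i ≢ j → SharesExactlyTerminals (paths i) (paths j) s t
    locate   : ∀ {v} → v ∈V B → ∃ λ i → v ∈ vertices (Branch.path (branch i))

badPiece⇒Theta : ∀ {B} → BadPiece B → Theta B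
badPiece⇒Theta {B} (_ , s , t , P₁ , P₂ , P₃ , path₁ , path₂ , path₃ , sh₁₂ , sh₁₃ , sh₂₃ , B≃ , rb₁ , rb₂ , rb₃ , _) =
  record { s = s ; t = t ; paths = paths ; branch = branch ; separate = separate ; locate = locate }
  where
  paths : Fin 3 → CGraph
  paths zero             = P₁
  paths (suc zero)       = P₂
  paths (suc (suc zero)) = P₃

  isPath : ∀ i → IsPath (paths i) s t
  isPath zero             = path₁
  isPath (suc zero)       = path₂
  isPath (suc (suc zero)) = path₃

  rainbow : ∀ i → Rainbow (paths i)
  rainbow zero             = rb₁
  rainbow (suc zero)       = rb₂
  rainbow (suc (suc zero)) = rb₃

  separate : ∀ {i j} → i ≢ j → SharesExactlyTerminals (paths i) (paths j) s t
  separate {zero}             {zero}             i≢j = ⊥-elim (i≢j refl)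
  separate {zero}             {suc zero}         _   = sh₁₂
  separate {zero}             {suc (suc zero)}   _   = sh₁₃
  separate {suc zero}         {zero}             _   = SharesExactlyTerminals-sym sh₁₂
  separate {suc zero}         {suc zero}         i≢j = ⊥-elim (i≢j refl)
  separate {suc zero}         {suc (suc zero)}   _   = sh₂₃
  separate {suc (suc zero)}   {zero}             _   = SharesExactlyTerminals-sym sh₁₃
  separate {suc (suc zero)}   {suc zero}         _   = SharesExactlyTerminals-sym sh₂₃
  separate {suc (suc zero)}   {suc (suc zero)}   i≢j = ⊥-elim (i≢j refl)

  inSome : ∀ {R : CEdge → Set} → Any R (P₁ ++ P₂ ++ P₃) → ∃ λ i → Any R (paths i)
  inSome R∈ with AnyP.++⁻ P₁ R∈
  ... | inj₁ R∈₁ = zero , R∈₁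
  ... | inj₂ R∈₂₃ with AnyP.++⁻ P₂ R∈₂₃
  ...   | inj₁ R∈₂ = suc zero , R∈₂
  ...   | inj₂ R∈₃ = suc (suc zero) , R∈₃

  inAll : ∀ {R : CEdge → Set} i → Any R (paths i) → Any R (P₁ ++ P₂ ++ P₃)
  inAll zero             = AnyP.++⁺ˡ
  inAll (suc zero)       = AnyP.++⁺ʳ P₁ ∘ AnyP.++⁺ˡ
  inAll (suc (suc zero)) = AnyP.++⁺ʳ P₁ ∘ AnyP.++⁺ʳ P₂

  owns : ∀ i {z} → z ∈ B → EdgeIn (end₁ z) (end₂ z) (paths i) → z ∈C paths i
  owns i {z} z∈B z∈i with inSome (Equivalence.to (B≃ z) (∈⇒∈C z∈B))
  ... | j , z∈j with i Fin.≟ j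
  ...   | yes refl = z∈j
  ...   | no i≢j   = ⊥-elim (proj₂ (separate i≢j) _ _ z∈i (∈C⇒EdgeIn z∈j))

  branch : ∀ i → Branch B (paths i) s t
  branch i = isPath⇒Branch (isPath i) (rainbow i) (λ z → Equivalence.from (B≃ z) ∘ inAll i) (owns i)

  locate : ∀ {v} → v ∈V B → ∃ λ i → v ∈ vertices (Branch.path (branch i))
  locate v∈B with inSome (∈V-mono (λ z → Equivalence.to (B≃ z)) v∈B)
  ... | i , v∈i = i , Branch.∈V⇒∈path (branch i) v∈i

module _ {B} (wf : WellFormed B) (almostRainbow : AlmostRainbow B) (θ : Theta B) where
  open Theta θ

  rainbowPath-inTheta : ∀ {v₁ v₂} → v₁ ∈V B → v₂ ∈V B → v₁ ≢ v₂ → RainbowPathIn B v₁ v₂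
  rainbowPath-inTheta v₁∈B v₂∈B v₁≢v₂ with locate v₁∈B | locate v₂∈B
  ... | i , v₁∈i | j , v₂∈j with i Fin.≟ j
  ...   | yes refl = rainbowPath-withinBranch wf (branch i) v₁∈i v₂∈j v₁≢v₂
  ...   | no i≢j   =
    rainbowPath-acrossBranches wf almostRainbow (branch i) (branch j) (separate i≢j) v₁∈i v₂∈j v₁≢v₂

mainTheorem2 : (B : CGraph) → BadPiece B →
    (v₁ v₂ : Vertex) → v₁ ∈V B → v₂ ∈V B → v₁ ≢ v₂ →
    Σ CGraph (λ H → Subgraph H B × IsPath H v₁ v₂ × Rainbow H)
mainTheorem2 B bad@(wf , _ , _ , _ , _ , _ , _ , _ , _ , _ , _ , _ , _ , _ , _ , _ , almostRainbow , _) v₁ v₂ =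
  rainbowPath-inTheta wf almostRainbow (badPiece⇒Theta bad)
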